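{- Let $\mathcal A\in\mathsf{Struc}_{c_1,c_2}$ contain the identity relation ${\rm id}_{U_{\mathcal A}}$ among its relations, and let $Q=\{c_1,c_2\}^\infty$. Then $\{{\rm Res}_{\mathcal M}\mid\mathcal M\in\mathsf M^{\rm NDB}_{\mathcal A}\}\subseteq\{{\rm Res}_{\mathcal M}\mid\mathcal M\in\mathsf M^\nu_{\mathcal A}(Q)\}$.
   Context: A first-order structure $\mathcal A=(U_{\mathcal A};(c_i)_{i\in N_1};(f_i)_{i\in N_2};(r_i)_{i\in N_3})$ of finite signature consists of a universe, constants, operations and relations; ${\rm id}_{U_{\mathcal A}}=\{(x,x)\mid x\in U_{\mathcal A}\}$; $U_{\mathcal A}^\infty=\bigcup_{n\ge 1}U_{\mathcal A}^n$; $\{c_1,c_2\}^\infty=\bigcup_{n\ge1}\{c_1,c_2\}^n$. $\mathsf{Struc}_{c_1,c_2}$ is the class of structures having two distinct elements $c_1\ne c_2$ among their constants. A (deterministic) BSS RAM over $\mathcal A$ has registers $Z_1,Z_2,\dots$ for elements of $U_{\mathcal A}$, finitely many index registers $I_1,\dots,I_k$ for positive integers, and a finite program of labeled instructions ending with stop; instructions: $Z_j:=f_i(Z_{j_1},\dots,Z_{j_m})$, $Z_j:=c_i$, $Z_j:=Z_k$, $Z_{I_j}:=Z_{I_k}$, $I_j:=1$, $I_j:=I_j+1$, "if $r_i(Z_{j_1},\dots,Z_{j_k})$ then goto $\ell_1$ else goto $\ell_2$", "if $I_j=I_k$ then goto $\ell_1$ else goto $\ell_2$", stop, using only the constants, operations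 and relations of $\mathcal A$; on input $(x_1,\dots,x_n)$ it starts at label 1 with $Z_i=x_i$ ($i\le n$), $Z_i=x_n$ ($i>n$), $I_1=n$, other index registers $1$, and outputs $(Z_1,\dots,Z_{I_1})$ at stop. $\mathsf M^{\rm NDB}_{\mathcal A}$: such machines that may additionally use "$\ell$: goto $\ell_1$ or goto $\ell_2$" (nondeterministic continuation at $\ell_1$ or $\ell_2$). $\mathsf M^\nu_{\mathcal A}(Q)$ for $Q\subseteq U_{\mathcal A}^\infty$: such machines that may additionally use Moschovakis' operator instructions $Z_j:=\nu[\mathcal O](\text{argument registers})$, which nondeterministically assign to $Z_j$ some $y\in U_{\mathcal A}$ with $(\vec z,y)\in Q$, $\vec z$ being the contents of the argument registers (no continuation if no such $y$ exists). For a nondeterministic machine $\mathcal M$, ${\rm Res}_{\mathcal M}:U_{\mathcal A}^\infty\to\mathfrak P(U_{\mathcal A}^\infty)$ maps $\vec x$ to the set of outputs of all computations on $\vec x$ that reach stop. -}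

module Defs where

open import Data.Nat using (ℕ; zero; suc; _<?_)
import Data.Vec.Relation.Unary.All as VAll
open import Data.Fin using (Fin; zero; suc; toℕ; fromℕ; fromℕ<)
open import Data.Bool using (Bool; true; false; if_then_else_)
open import Data.Vec using (Vec; []; _∷_; lookup; tabulate)
import Data.Vec as V
open import Data.List using (List; []; _∷_)
import Data.List as L
open import Data.List.Relation.Unary.All using (All)
open import Data.Product using (Σ; Σ-syntax; ∃; ∃-syntax; _×_; _,_)
open import Data.Sum using (_⊎_)
open import Data.Empty using (⊥)
open import Relation.Nullary using (¬_; yes; no)
open import Relation.Binary.PropositionalEquality using (_≡_; _≢_; subst; sym)
open import Relation.Binary.Construct.Closure.ReflexiveTransitive using (Star)
open import Function.Bundles using (_⇔_)
open import Data.Nat.Properties using (_≟_; ≤-refl)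
open import Relation.Nullary.Decidable using (⌊_⌋)

record Structure : Set₁ where
  field
    U       : Set
    nConst  : ℕ
    const   : Fin nConst → U
    nOp     : ℕ
    opAr    : Fin nOp → ℕ
    op      : (i : Fin nOp) → Vec U (opAr i) → U
    nRel    : ℕ
    relAr   : Fin nRel → ℕ
    rel     : (i : Fin nRel) → Vec U (relAr i) → Set

open Structure public

-- U^∞ = ⋃_{n ≥ 1} U^n : a tuple of length (suc n) is represented as (n , v).
_^∞ : Set → Set
X ^∞ = Σ ℕ λ n → Vec X (suc n)

HasIdRelation : Structure → Set
HasIdRelation A =
  Σ (Fin (nRel A)) λ i → Σ (relAr A i ≡ 2) λ p →
    ∀ (a b : U A) → rel A i (subst (Vec (U A)) (sym p) (a ∷ b ∷ [])) ⇔ (a ≡ b)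

PairInf : {X : Set} → X → X → X ^∞ → Set
PairInf c₁ c₂ (n , v) = VAll.All (λ u → u ≡ c₁ ⊎ u ≡ c₂) v

-- Conventions: register Z_{m+1} is addressed by the natural number m
-- (0-based); the index registers are I_1,...,I_k addressed by Fin k
-- (I_1 = zero); labels 1,...,L are addressed by Fin L (label 1 = zero).

data Instr (A : Structure) (k L : ℕ) : Set where
  opI     : (j : ℕ) (i : Fin (nOp A)) → Vec ℕ (opAr A i) → Instr A k L
  constI  : (j : ℕ) → Fin (nConst A) → Instr A k L
  copyI   : (j m : ℕ) → Instr A k L
  icopyI  : (j m : Fin k) → Instr A k L                                  -- Z_{I_j} := Z_{I_m}
  isetI   : Fin k → Instr A k L                                          -- I_j := 1
  iincI   : Fin k → Instr A k L
  ifRelI  : (i : Fin (nRel A)) → Vec ℕ (relAr A i) → Fin L → Fin L → Instr A k L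
  ifIdxI  : Fin k → Fin k → Fin L → Fin L → Instr A k L
  stopI   : Instr A k L
  chooseI : Fin L → Fin L → Instr A k L
  nuI     : (j : ℕ) → List ℕ → Instr A k L                               -- Z_j := ν[O](Z_args)

isChoose : ∀ {A k L} → Instr A k L → Bool
isChoose (chooseI _ _) = true
isChoose _ = false

isNu : ∀ {A k L} → Instr A k L → Bool
isNu (nuI _ _) = true
isNu _ = false

record Machine (A : Structure) : Set where
  field
    nIdx     : ℕ
    len      : ℕ
    prog     : Fin (suc len) → Instr A (suc nIdx) (suc len)
    lastStop : prog (fromℕ len) ≡ stopI

open Machine public

IsNDB : ∀ {A} → Machine A → Set
IsNDB M = ∀ l → isNu (prog M l) ≡ false

IsNu : ∀ {A} → Machine A → Set
IsNu M = ∀ l → isChoose (prog M l) ≡ false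

-- Index register contents: stored value v stands for the positive integer suc v.
record Config (A : Structure) (k L : ℕ) : Set where
  constructor cfg
  field
    label : Fin L
    Z     : ℕ → U A
    I     : Fin k → ℕ

open Config public

upd : {X : Set} → (ℕ → X) → ℕ → X → (ℕ → X)
upd f j x m = if ⌊ m ≟ j ⌋ then x else f m

updI : ∀ {k} → (Fin k → ℕ) → Fin k → ℕ → (Fin k → ℕ)
updI f j x m = if ⌊ toℕ m ≟ toℕ j ⌋ then x else f m

-- One step of the machine M, where ν-instructions are interpreted via the
-- oracle Q ⊆ U^∞ (a predicate).  (z⃗ , y) is represented by the list z⃗ ++ [y].
toInf : {X : Set} → List X → X → X ^∞
toInf [] y = 0 , y ∷ []
toInf (z ∷ zs) y with toInf zs y
... | n , v = suc n , z ∷ v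

data Step {A : Structure} (M : Machine A) (Q : U A ^∞ → Set)
     : Config A (suc (nIdx M)) (suc (len M)) → Config A (suc (nIdx M)) (suc (len M)) → Set where
  st-op : ∀ {l Z I j i js} → prog M l ≡ opI j i js → (next : Fin (suc (len M))) →
       toℕ next ≡ suc (toℕ l) →
       Step M Q (cfg l Z I) (cfg next (upd Z j (op A i (V.map Z js))) I)
  st-const : ∀ {l Z I j i} → prog M l ≡ constI j i → (next : Fin (suc (len M))) →
       toℕ next ≡ suc (toℕ l) →
       Step M Q (cfg l Z I) (cfg next (upd Z j (const A i)) I)
  st-copy : ∀ {l Z I j m} → prog M l ≡ copyI j m → (next : Fin (suc (len M))) →
       toℕ next ≡ suc (toℕ l) →
       Step M Q (cfg l Z I) (cfg next (upd Z j (Z m)) I)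
  st-icopy : ∀ {l Z I j m} → prog M l ≡ icopyI j m → (next : Fin (suc (len M))) →
       toℕ next ≡ suc (toℕ l) →
       Step M Q (cfg l Z I) (cfg next (upd Z (I j) (Z (I m))) I)
  st-iset : ∀ {l Z I j} → prog M l ≡ isetI j → (next : Fin (suc (len M))) →
       toℕ next ≡ suc (toℕ l) →
       Step M Q (cfg l Z I) (cfg next Z (updI I j 0))
  st-iinc : ∀ {l Z I j} → prog M l ≡ iincI j → (next : Fin (suc (len M))) →
       toℕ next ≡ suc (toℕ l) →
       Step M Q (cfg l Z I) (cfg next Z (updI I j (suc (I j))))
  st-ifRelYes : ∀ {l Z I i js l₁ l₂} → prog M l ≡ ifRelI i js l₁ l₂ →
       rel A i (V.map Z js) → Step M Q (cfg l Z I) (cfg l₁ Z I)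
  st-ifRelNo : ∀ {l Z I i js l₁ l₂} → prog M l ≡ ifRelI i js l₁ l₂ →
       ¬ rel A i (V.map Z js) → Step M Q (cfg l Z I) (cfg l₂ Z I)
  st-ifIdxYes : ∀ {l Z I j m l₁ l₂} → prog M l ≡ ifIdxI j m l₁ l₂ →
       I j ≡ I m → Step M Q (cfg l Z I) (cfg l₁ Z I)
  st-ifIdxNo : ∀ {l Z I j m l₁ l₂} → prog M l ≡ ifIdxI j m l₁ l₂ →
       I j ≢ I m → Step M Q (cfg l Z I) (cfg l₂ Z I)
  st-choose₁ : ∀ {l Z I l₁ l₂} → prog M l ≡ chooseI l₁ l₂ →
       Step M Q (cfg l Z I) (cfg l₁ Z I)
  st-choose₂ : ∀ {l Z I l₁ l₂} → prog M l ≡ chooseI l₁ l₂ →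
       Step M Q (cfg l Z I) (cfg l₂ Z I)
  st-nu : ∀ {l Z I j args} → prog M l ≡ nuI j args → (y : U A) →
       Q (toInf (L.map Z args) y) → (next : Fin (suc (len M))) →
       toℕ next ≡ suc (toℕ l) →
       Step M Q (cfg l Z I) (cfg next (upd Z j y) I)

-- Initial configuration on input (x_1,...,x_{n+1}):
-- Z_i = x_i for i ≤ n+1, Z_i = x_{n+1} for i > n+1, I_1 = n+1, other I's = 1, label 1.
initZ : {X : Set} → X ^∞ → ℕ → X
initZ (n , xs) m with m <? suc n
... | yes p = lookup xs (fromℕ< p)
... | no _  = lookup xs (fromℕ n)

initI : ∀ {k} → ℕ → Fin (suc k) → ℕ
initI n zero    = n
initI n (suc _) = 0

init : ∀ {A} (M : Machine A) → U A ^∞ → Config A (suc (nIdx M)) (suc (len M))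
init M x@(n , _) = cfg zero (initZ x) (initI n)

output : ∀ {A k L} → Config A (suc k) L → U A ^∞
output c = I c zero , tabulate (λ i → Z c (toℕ i))

Res : ∀ {A} (M : Machine A) (Q : U A ^∞ → Set) → U A ^∞ → U A ^∞ → Set
Res M Q x y = Σ (Config _ _ _) λ c →
  Star (Step M Q) (init M x) c × prog M (label c) ≡ stopI × output c ≡ y

-- Res for machines without ν-instructions (the oracle is never consulted;
-- we instantiate it with the empty predicate).
ResNDB : ∀ {A} (M : Machine A) → U A ^∞ → U A ^∞ → Set
ResNDB M = Res M (λ _ → ⊥)

{-# OPTIONS --safe #-}
module Submission where

-- The machine M′ runs M's program block by block on the same registers. An instruction
-- "goto a or goto b" becomes: save registers 0 and 1, set register 0 := ν (some y ∈ {c₁, c₂})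
-- and register 1 := c₁, branch to a or b according to whether id holds of the two, and
-- restore them. The save slots must be registers whose contents M never observes: M′ keeps in an extra index register a bound
-- above every register M has addressed so far, above which all registers still hold their
-- initial value; the slots are bound + 1 and bound + 2, and the bound is raised whenever an
-- index register of M reaches it. Conversely, every step of M′ except a ν-query is forced, so
-- a halting run of M′ splits into the simulations of single steps of M.

open import Defs
open import Data.Nat using (ℕ; zero; suc; _+_; _*_; _∸_; _≤_; _<_; z≤n; s≤s; s≤s⁻¹; _<?_)
open import Data.Nat.Properties
open import Data.Nat.Tactic.RingSolver using (solve-∀)
open import Data.Fin using (Fin; zero; suc; toℕ; fromℕ; fromℕ<; inject₁; _↑ˡ_; _↑ʳ_; combine; remQuot; splitAt; #_)
import Data.Fin.Properties as Fin
open import Data.Bool using (true; false)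
open import Data.Empty using (⊥)
open import Data.Product using (Σ; ∃; ∃₂; _×_; _,_; proj₂)
open import Data.Sum using (_⊎_; inj₁; inj₂; [_,_]′)
open import Data.Vec using (Vec; []; _∷_)
import Data.Vec as V
import Data.Vec.Properties as V
import Data.Vec.Relation.Unary.All as VAll
import Data.List as L
open import Data.List.Relation.Unary.All.Properties using (tabulate⁻)
open import Data.List.Extrema.Nat using (max; xs≤max)
open import Function using (_∘_)
open import Function.Bundles using (_⇔_; mk⇔; Equivalence)
open import Relation.Nullary using (¬_; yes; no; contradiction)
open import Relation.Nullary.Decidable using (toSum)
open import Relation.Binary.PropositionalEquality
open import Relation.Binary.Construct.Closure.ReflexiveTransitive using (Star; ε; _◅_; _◅◅_)
open import Relation.Binary.Construct.Closure.Transitive using (TransClosure; [_]; _∷_; _++_)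

-- Register files

module _ {X : Set} where

  upd-updates : ∀ (f : ℕ → X) j x → upd f j x j ≡ x
  upd-updates f j x with j ≟ j
  ... | yes _   = refl
  ... | no j≢j = contradiction refl j≢j

  upd-minimal : ∀ (f : ℕ → X) j x {m} → m ≢ j → upd f j x m ≡ f m
  upd-minimal f j x {m} m≢j with m ≟ j
  ... | yes m≡j = contradiction m≡j m≢j
  ... | no _    = refl

  upd-cong : ∀ {f g : ℕ → X} j {x y} → x ≡ y → f ≗ g → upd f j x ≗ upd g j y
  upd-cong j refl f≗g m with m ≟ j
  ... | yes _ = refl
  ... | no _  = f≗g m

  copyAt : (ℕ → X) → ℕ → ℕ → ℕ → X
  copyAt Z a b = upd Z a (Z b)

  -- The registers inside the choice gadget: after saving a₀, a₁ to the slots s₀, s₁ and writing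
  -- y, c to 0, 1; and after copying the slots back and resetting them from register p.
  probe : (ℕ → X) → (s₀ s₁ a₀ a₁ : ℕ) → X → X → ℕ → X
  probe Z s₀ s₁ a₀ a₁ y c = upd (upd (copyAt (copyAt Z s₀ a₀) s₁ a₁) 0 y) 1 c

  unprobe : (ℕ → X) → (s₀ s₁ a₀ a₁ p : ℕ) → ℕ → X
  unprobe W s₀ s₁ a₀ a₁ p = copyAt (copyAt (copyAt (copyAt W a₀ s₀) a₁ s₁) s₀ p) s₁ p

  restore₀₁ : ∀ (W : ℕ → X) s t y c → s ≢ 0 → s ≢ 1 → t ≢ 0 → t ≢ 1 → W s ≡ W 0 → W t ≡ W 1 →
              copyAt (copyAt (upd (upd W 0 y) 1 c) 0 s) 1 t ≗ W
  restore₀₁ W s t y c s≢0 s≢1 t≢0 t≢1 Ws≡W0 Wt≡W1 m = by-cases m (toSum (m ≟ 1)) (toSum (m ≟ 0))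
    where
      open ≡-Reasoning
      V V′ : ℕ → X
      V  = upd (upd W 0 y) 1 c
      V′ = copyAt V 0 s
      by-cases : ∀ m → m ≡ 1 ⊎ m ≢ 1 → m ≡ 0 ⊎ m ≢ 0 → copyAt V′ 1 t m ≡ W m
      by-cases _ (inj₁ refl) _ = begin
        copyAt V′ 1 t 1 ≡⟨ upd-updates V′ 1 (V′ t) ⟩
        V′ t            ≡⟨ upd-minimal V 0 (V s) t≢0 ⟩
        V t             ≡⟨ upd-minimal (upd W 0 y) 1 c t≢1 ⟩
        upd W 0 y t     ≡⟨ upd-minimal W 0 y t≢0 ⟩
        W t             ≡⟨ Wt≡W1 ⟩
        W 1             ∎
      by-cases _ (inj₂ m≢1) (inj₁ refl) = begin
        copyAt V′ 1 t 0 ≡⟨ upd-minimal V′ 1 (V′ t) m≢1 ⟩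
        V′ 0            ≡⟨ upd-updates V 0 (V s) ⟩
        V s             ≡⟨ upd-minimal (upd W 0 y) 1 c s≢1 ⟩
        upd W 0 y s     ≡⟨ upd-minimal W 0 y s≢0 ⟩
        W s             ≡⟨ Ws≡W0 ⟩
        W 0             ∎
      by-cases m (inj₂ m≢1) (inj₂ m≢0) = begin
        copyAt V′ 1 t m ≡⟨ upd-minimal V′ 1 (V′ t) m≢1 ⟩
        V′ m            ≡⟨ upd-minimal V 0 (V s) m≢0 ⟩
        V m             ≡⟨ upd-minimal (upd W 0 y) 1 c m≢1 ⟩
        upd W 0 y m     ≡⟨ upd-minimal W 0 y m≢0 ⟩
        W m             ∎

  clear-slots : ∀ (W Z : ℕ → X) s t p → (∀ m → m ≢ s → m ≢ t → W m ≡ Z m) → Z s ≡ Z p → Z t ≡ Z p →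
                p ≢ s → p ≢ t → s ≢ t → copyAt (copyAt W s p) t p ≗ Z
  clear-slots W Z s t p W≈Z Zs≡Zp Zt≡Zp p≢s p≢t s≢t m with toSum (m ≟ t) | toSum (m ≟ s)
  ... | inj₁ refl | _ = begin
    copyAt (copyAt W s p) m p m ≡⟨ upd-updates (copyAt W s p) m (copyAt W s p p) ⟩
    copyAt W s p p              ≡⟨ upd-minimal W s (W p) p≢s ⟩
    W p                         ≡⟨ W≈Z p p≢s p≢t ⟩
    Z p                         ≡⟨ Zt≡Zp ⟨
    Z m                         ∎
    where open ≡-Reasoning
  ... | inj₂ m≢t | inj₁ refl = begin
    copyAt (copyAt W m p) t p m ≡⟨ upd-minimal (copyAt W m p) t (copyAt W m p p) m≢t ⟩
    copyAt W m p m              ≡⟨ upd-updates W m (W p) ⟩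
    W p                         ≡⟨ W≈Z p p≢s p≢t ⟩
    Z p                         ≡⟨ Zs≡Zp ⟨
    Z m                         ∎
    where open ≡-Reasoning
  ... | inj₂ m≢t | inj₂ m≢s = begin
    copyAt (copyAt W s p) t p m ≡⟨ upd-minimal (copyAt W s p) t (copyAt W s p p) m≢t ⟩
    copyAt W s p m              ≡⟨ upd-minimal W s (W p) m≢s ⟩
    W m                         ≡⟨ W≈Z m m≢s m≢t ⟩
    Z m                         ∎
    where open ≡-Reasoning

  unprobe-probe : ∀ (Z : ℕ → X) p y c → 2 ≤ p → Z (1 + p) ≡ Z p → Z (2 + p) ≡ Z p →
                  unprobe (probe Z (1 + p) (2 + p) 0 1 y c) (1 + p) (2 + p) 0 1 p ≗ Z
  unprobe-probe Z p y c 2≤p Zs≡Zp Zt≡Zp =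
    clear-slots restored Z s t p restored≈Z Zs≡Zp Zt≡Zp (<⇒≢ (n<1+n p)) (<⇒≢ (m<n⇒m<1+n (n<1+n p))) (<⇒≢ (n<1+n s))
    where
      s t : ℕ
      s = 1 + p
      t = 2 + p
      saved restored : ℕ → X
      saved    = copyAt (copyAt Z s 0) t 1
      restored = copyAt (copyAt (upd (upd saved 0 y) 1 c) 0 s) 1 t
      s≢1 : s ≢ 1
      s≢1 refl = contradiction 2≤p λ ()
      saved-s : saved s ≡ saved 0
      saved-s = begin
        saved s            ≡⟨ upd-minimal (copyAt Z s 0) t (copyAt Z s 0 1) (<⇒≢ (n<1+n s)) ⟩
        copyAt Z s 0 s     ≡⟨ upd-updates Z s (Z 0) ⟩
        Z 0                ≡⟨ upd-minimal Z s (Z 0) {0} (λ ()) ⟨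
        copyAt Z s 0 0     ≡⟨ upd-minimal (copyAt Z s 0) t (copyAt Z s 0 1) {0} (λ ()) ⟨
        saved 0            ∎
        where open ≡-Reasoning
      saved-t : saved t ≡ saved 1
      saved-t = trans (upd-updates (copyAt Z s 0) t (copyAt Z s 0 1)) (sym (upd-minimal (copyAt Z s 0) t (copyAt Z s 0 1) {1} λ ()))
      restored≈Z : ∀ m → m ≢ s → m ≢ t → restored m ≡ Z m
      restored≈Z m m≢s m≢t = begin
        restored m         ≡⟨ restore₀₁ saved s t y c (λ ()) s≢1 (λ ()) (λ ()) saved-s saved-t m ⟩
        saved m            ≡⟨ upd-minimal (copyAt Z s 0) t (copyAt Z s 0 1) m≢t ⟩
        copyAt Z s 0 m     ≡⟨ upd-minimal Z s (Z 0) m≢s ⟩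
        Z m                ∎
        where open ≡-Reasoning

module _ {k : ℕ} where

  updI-updates : ∀ (f : Fin k → ℕ) j v → updI f j v j ≡ v
  updI-updates f j v with toℕ j ≟ toℕ j
  ... | yes _   = refl
  ... | no j≢j = contradiction refl j≢j

  updI-minimal : ∀ (f : Fin k → ℕ) j v {m} → m ≢ j → updI f j v m ≡ f m
  updI-minimal f j v {m} m≢j with toℕ m ≟ toℕ j
  ... | yes m≡j = contradiction (Fin.toℕ-injective m≡j) m≢j
  ... | no _    = refl

  incr : (Fin k → ℕ) → Fin k → Fin k → ℕ
  incr f j = updI f j (suc (f j))

-- Runs of an arbitrary machine

-- A record, not the bare equation, so that both labels can be read off its type.
record _↦_ {n} (l l′ : Fin n) : Set where
  constructor mk↦
  field toℕ-suc : toℕ l′ ≡ suc (toℕ l)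
open _↦_

↦-unique : ∀ {n} {l l′ l″ : Fin n} → l ↦ l′ → l ↦ l″ → l′ ≡ l″
↦-unique (mk↦ e) (mk↦ e′) = Fin.toℕ-injective (trans e (sym e′))

steps : ∀ {X : Set} {R : X → X → Set} {x y} → Star R x y → ℕ
steps ε       = 0
steps (_ ◅ r) = suc (steps r)

choice-view : ∀ {A k L} {ins : Instr A k L} → isChoose ins ≡ true → ∃₂ λ a b → ins ≡ chooseI a b
choice-view {ins = chooseI a b} refl = a , b , refl

module Semantics {A : Structure} (N : Machine A) (Q : U A ^∞ → Set) where

  Label : Set
  Label = Fin (suc (len N))

  Conf : Set
  Conf = Config A (suc (nIdx N)) (suc (len N))

  Ins : Set
  Ins = Instr A (suc (nIdx N)) (suc (len N))

  _⟶_ : Conf → Conf → Set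
  _⟶_ = Step N Q

  _⟶*_ : Conf → Conf → Set
  _⟶*_ = Star _⟶_

  Halted : Conf → Set
  Halted c = prog N (label c) ≡ stopI

  Advance : Label → (ℕ → U A) → (Fin (suc (nIdx N)) → ℕ) → Conf → Set
  Advance l Z I d = ∃ λ l′ → l ↦ l′ × d ≡ cfg l′ Z I

  Effect : Ins → Conf → Conf → Set
  Effect (opI j i js)       (cfg l Z I) = Advance l (upd Z j (op A i (V.map Z js))) I
  Effect (constI j i)       (cfg l Z I) = Advance l (upd Z j (const A i)) I
  Effect (copyI j m)        (cfg l Z I) = Advance l (upd Z j (Z m)) I
  Effect (icopyI j m)       (cfg l Z I) = Advance l (upd Z (I j) (Z (I m))) I
  Effect (isetI j)          (cfg l Z I) = Advance l Z (updI I j 0)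
  Effect (iincI j)          (cfg l Z I) = Advance l Z (incr I j)
  Effect (ifRelI i js l₁ l₂) (cfg l Z I) d =
    rel A i (V.map Z js) × d ≡ cfg l₁ Z I ⊎ ¬ rel A i (V.map Z js) × d ≡ cfg l₂ Z I
  Effect (ifIdxI j m l₁ l₂) (cfg l Z I) d = I j ≡ I m × d ≡ cfg l₁ Z I ⊎ I j ≢ I m × d ≡ cfg l₂ Z I
  Effect stopI              _           _ = ⊥
  Effect (chooseI l₁ l₂)    (cfg l Z I) d = d ≡ cfg l₁ Z I ⊎ d ≡ cfg l₂ Z I
  Effect (nuI j args)       (cfg l Z I) d = ∃ λ y → Q (toInf (L.map Z args) y) × Advance l (upd Z j y) I d

  effect-of : ∀ {ins c d} → prog N (label c) ≡ ins → Effect ins c d → Effect (prog N (label c)) c d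
  effect-of p = subst (λ ins → Effect ins _ _) (sym p)

  step-effect : ∀ {c d} → c ⟶ d → Effect (prog N (label c)) c d
  step-effect (st-op p l′ e)     = effect-of p (l′ , mk↦ e , refl)
  step-effect (st-const p l′ e)  = effect-of p (l′ , mk↦ e , refl)
  step-effect (st-copy p l′ e)   = effect-of p (l′ , mk↦ e , refl)
  step-effect (st-icopy p l′ e)  = effect-of p (l′ , mk↦ e , refl)
  step-effect (st-iset p l′ e)   = effect-of p (l′ , mk↦ e , refl)
  step-effect (st-iinc p l′ e)   = effect-of p (l′ , mk↦ e , refl)
  step-effect (st-ifRelYes p r)  = effect-of p (inj₁ (r , refl))
  step-effect (st-ifRelNo p r)   = effect-of p (inj₂ (r , refl))
  step-effect (st-ifIdxYes p e)  = effect-of p (inj₁ (e , refl))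
  step-effect (st-ifIdxNo p e)   = effect-of p (inj₂ (e , refl))
  step-effect (st-choose₁ p)     = effect-of p (inj₁ refl)
  step-effect (st-choose₂ p)     = effect-of p (inj₂ refl)
  step-effect (st-nu p y q l′ e) = effect-of p (y , q , l′ , mk↦ e , refl)

  effect-at : ∀ {ins c d} → prog N (label c) ≡ ins → c ⟶ d → Effect ins c d
  effect-at p s = subst (λ ins → Effect ins _ _) p (step-effect s)

  advance-to : ∀ {l l′ Z I d} → Advance l Z I d → l ↦ l′ → d ≡ cfg l′ Z I
  advance-to (_ , e , refl) e′ = cong (λ l → cfg l _ _) (↦-unique e e′)

  halted-stuck : ∀ {c d} → Halted c → ¬ (c ⟶ d)
  halted-stuck h s = effect-at h s

  halted-run : ∀ {c e} → Halted c → c ⟶* e → c ≡ e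
  halted-run h ε       = refl
  halted-run h (s ◅ _) = contradiction s (halted-stuck h)

  first-step : ∀ {c e} → ¬ Halted c → Halted e → (r : c ⟶* e) →
               ∃ λ d → c ⟶ d × Σ (d ⟶* e) λ r′ → steps r′ < steps r
  first-step ¬h h ε       = contradiction h ¬h
  first-step ¬h h (s ◅ r) = _ , s , r , ≤-refl

  effect-functional : ∀ ins {c d d′} → isChoose ins ≡ false → isNu ins ≡ false →
                      Effect ins c d → Effect ins c d′ → d ≡ d′
  effect-functional (opI _ _ _)      _ _ a          (_ , e , refl) = advance-to a e
  effect-functional (constI _ _)     _ _ a          (_ , e , refl) = advance-to a e
  effect-functional (copyI _ _)      _ _ a          (_ , e , refl) = advance-to a e
  effect-functional (icopyI _ _)     _ _ a          (_ , e , refl) = advance-to a e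
  effect-functional (isetI _)        _ _ a          (_ , e , refl) = advance-to a e
  effect-functional (iincI _)        _ _ a          (_ , e , refl) = advance-to a e
  effect-functional (ifRelI _ _ _ _) _ _ (inj₁ (_ , refl)) (inj₁ (_ , refl)) = refl
  effect-functional (ifRelI _ _ _ _) _ _ (inj₁ (r , _))    (inj₂ (¬r , _))   = contradiction r ¬r
  effect-functional (ifRelI _ _ _ _) _ _ (inj₂ (¬r , _))   (inj₁ (r , _))    = contradiction r ¬r
  effect-functional (ifRelI _ _ _ _) _ _ (inj₂ (_ , refl)) (inj₂ (_ , refl)) = refl
  effect-functional (ifIdxI _ _ _ _) _ _ (inj₁ (_ , refl)) (inj₁ (_ , refl)) = refl
  effect-functional (ifIdxI _ _ _ _) _ _ (inj₁ (e , _))    (inj₂ (¬e , _))   = contradiction e ¬e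
  effect-functional (ifIdxI _ _ _ _) _ _ (inj₂ (¬e , _))   (inj₁ (e , _))    = contradiction e ¬e
  effect-functional (ifIdxI _ _ _ _) _ _ (inj₂ (_ , refl)) (inj₂ (_ , refl)) = refl
  effect-functional stopI            _ _ ()

  ⟶-functional : ∀ {c d d′} → isChoose (prog N (label c)) ≡ false → isNu (prog N (label c)) ≡ false →
                 c ⟶ d → c ⟶ d′ → d ≡ d′
  ⟶-functional nc nn s s′ = effect-functional _ nc nn (step-effect s) (step-effect s′)

  ForcedStep : Conf → Conf → Set
  ForcedStep c d = c ⟶ d × (∀ {d′} → c ⟶ d′ → d′ ≡ d)

  _⇛_ : Conf → Conf → Set
  _⇛_ = TransClosure ForcedStep

  forced : ∀ {ins c d} → prog N (label c) ≡ ins → isChoose ins ≡ false → isNu ins ≡ false →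
           c ⟶ d → ForcedStep c d
  forced p nc nn s = s , λ s′ → ⟶-functional (trans (cong isChoose p) nc) (trans (cong isNu p) nn) s′ s

  ⇛⇒⟶* : ∀ {c d} → c ⇛ d → c ⟶* d
  ⇛⇒⟶* [ s , _ ]     = s ◅ ε
  ⇛⇒⟶* ((s , _) ∷ f) = s ◅ ⇛⇒⟶* f

  ⇛-suffix : ∀ {c d e} → c ⇛ d → Halted e → (r : c ⟶* e) → Σ (d ⟶* e) λ r′ → steps r′ < steps r
  ⇛-suffix [ s , _ ]        h ε        = contradiction s (halted-stuck h)
  ⇛-suffix [ _ , unique ]   h (s ◅ r) with unique s
  ... | refl = r , ≤-refl
  ⇛-suffix ((s , _) ∷ f)      h ε        = contradiction s (halted-stuck h)
  ⇛-suffix ((_ , unique) ∷ f) h (s ◅ r) with unique s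
  ... | refl with ⇛-suffix f h r
  ...   | r′ , r′<r = r′ , m<n⇒m<1+n r′<r

  module _ {l l′ : Label} {Z : ℕ → U A} {I : Fin (suc (nIdx N)) → ℕ} where

    op⇀ : ∀ {j i js} → prog N l ≡ opI j i js → l ↦ l′ →
          ForcedStep (cfg l Z I) (cfg l′ (upd Z j (op A i (V.map Z js))) I)
    op⇀ p e = forced p refl refl (st-op p _ (toℕ-suc e))

    const⇀ : ∀ {j i} → prog N l ≡ constI j i → l ↦ l′ → ForcedStep (cfg l Z I) (cfg l′ (upd Z j (const A i)) I)
    const⇀ p e = forced p refl refl (st-const p _ (toℕ-suc e))

    copy⇀ : ∀ {j m} → prog N l ≡ copyI j m → l ↦ l′ → ForcedStep (cfg l Z I) (cfg l′ (upd Z j (Z m)) I)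
    copy⇀ p e = forced p refl refl (st-copy p _ (toℕ-suc e))

    icopy⇀ : ∀ {j m} → prog N l ≡ icopyI j m → l ↦ l′ →
             ForcedStep (cfg l Z I) (cfg l′ (upd Z (I j) (Z (I m))) I)
    icopy⇀ p e = forced p refl refl (st-icopy p _ (toℕ-suc e))

    iset⇀ : ∀ {j} → prog N l ≡ isetI j → l ↦ l′ → ForcedStep (cfg l Z I) (cfg l′ Z (updI I j 0))
    iset⇀ p e = forced p refl refl (st-iset p _ (toℕ-suc e))

    iinc⇀ : ∀ {j} → prog N l ≡ iincI j → l ↦ l′ → ForcedStep (cfg l Z I) (cfg l′ Z (incr I j))
    iinc⇀ p e = forced p refl refl (st-iinc p _ (toℕ-suc e))

  module _ {l : Label} {Z : ℕ → U A} {I : Fin (suc (nIdx N)) → ℕ} where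

    ifRel-yes⇀ : ∀ {i js l₁ l₂} → prog N l ≡ ifRelI i js l₁ l₂ → rel A i (V.map Z js) →
                 ForcedStep (cfg l Z I) (cfg l₁ Z I)
    ifRel-yes⇀ p r = forced p refl refl (st-ifRelYes p r)

    ifRel-no⇀ : ∀ {i js l₁ l₂} → prog N l ≡ ifRelI i js l₁ l₂ → ¬ rel A i (V.map Z js) →
                ForcedStep (cfg l Z I) (cfg l₂ Z I)
    ifRel-no⇀ p r = forced p refl refl (st-ifRelNo p r)

    ifIdx-yes⇀ : ∀ {j m l₁ l₂} → prog N l ≡ ifIdxI j m l₁ l₂ → I j ≡ I m → ForcedStep (cfg l Z I) (cfg l₁ Z I)
    ifIdx-yes⇀ p e = forced p refl refl (st-ifIdxYes p e)

    ifIdx-no⇀ : ∀ {j m l₁ l₂} → prog N l ≡ ifIdxI j m l₁ l₂ → I j ≢ I m → ForcedStep (cfg l Z I) (cfg l₂ Z I)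
    ifIdx-no⇀ p e = forced p refl refl (st-ifIdxNo p e)

-- The simulating machine

module Simulator (A : Structure) (i₁ : Fin (nConst A)) (eqRel : Fin (nRel A)) (eqRel-arity : relAr A eqRel ≡ 2)
               (M : Machine A) where

  k : ℕ
  k = nIdx M

  Idx : Set
  Idx = Fin (suc k + 5)

  emb : Fin (suc k) → Idx
  emb j = j ↑ˡ 5

  extra : Fin 5 → Idx
  extra i = suc k ↑ʳ i

  -- addr₀ and addr₁ always hold 0 and 1, so that icopyI can move registers 0 and 1 to the save slots.
  bound save₀ save₁ addr₀ addr₁ : Idx
  bound = extra zero
  save₀ = extra (# 1)
  save₁ = extra (# 2)
  addr₀ = extra (# 3)
  addr₁ = extra (# 4)

  target : Instr A (suc k) (suc (len M)) → ℕ
  target (opI j _ _) = j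
  target (constI j _) = j
  target (copyI j _) = j
  target _ = 0

  -- A bound on the registers M writes through fixed addresses, and on 0 and 1.
  K : ℕ
  K = 2 + max 0 (L.tabulate (target ∘ prog M))

  len′ : ℕ
  len′ = 8 + (K * 3 + suc (len M) * 16)

  Lab : Set
  Lab = Fin (suc len′)

  Ins′ : Set
  Ins′ = Instr A (suc (k + 5)) (suc len′)

  -- The code of M′: a preamble of 9, then K blocks of 3 raising the bound, then 16 per label of M.
  pre : Fin 9 → Lab
  pre a = a ↑ˡ (K * 3 + suc (len M) * 16)

  bumpAt : Fin K → Fin 3 → Lab
  bumpAt t r = 9 ↑ʳ (combine t r ↑ˡ (suc (len M) * 16))

  blockAt : Fin (suc (len M)) → Fin 16 → Lab
  blockAt l r = 9 ↑ʳ (K * 3 ↑ʳ combine l r)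

  entry : Fin (suc (len M)) → Lab
  entry l = blockAt l zero

  nextLabel : Fin (suc (len M)) → Fin (suc (len M))
  nextLabel l with suc (toℕ l) <? suc (len M)
  ... | yes l+1<n = fromℕ< l+1<n
  ... | no _      = l

  goto : Lab → Ins′
  goto L = ifIdxI bound bound L L

  regs01 : Vec ℕ (relAr A eqRel)
  regs01 = subst (Vec ℕ) (sym eqRel-arity) (0 ∷ 1 ∷ [])

  -- Count the bound up to I₁ = n; the K bump blocks then raise it to n + K.
  preambleCode : ℕ → Ins′
  preambleCode 0 = iincI save₀
  preambleCode 1 = iincI save₁
  preambleCode 2 = iincI save₁
  preambleCode 3 = iincI addr₁
  preambleCode 4 = ifIdxI bound (emb zero) (bumpAt zero zero) (pre (# 5))
  preambleCode 5 = iincI bound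
  preambleCode 6 = iincI save₀
  preambleCode 7 = iincI save₁
  preambleCode _ = goto (pre (# 4))

  bumpCode : ℕ → Ins′
  bumpCode 0 = iincI bound
  bumpCode 1 = iincI save₀
  bumpCode _ = iincI save₁

  choiceCode : (l a b : Fin (suc (len M))) → ℕ → Ins′
  choiceCode l a b 0  = icopyI save₀ addr₀
  choiceCode l a b 1  = icopyI save₁ addr₁
  choiceCode l a b 2  = nuI 0 L.[]
  choiceCode l a b 3  = constI 1 i₁
  choiceCode l a b 4  = ifRelI eqRel regs01 (blockAt l (# 5)) (blockAt l (# 10))
  choiceCode l a b 5  = icopyI addr₀ save₀
  choiceCode l a b 6  = icopyI addr₁ save₁
  choiceCode l a b 7  = icopyI save₀ bound
  choiceCode l a b 8  = icopyI save₁ bound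
  choiceCode l a b 9  = goto (entry a)
  choiceCode l a b 10 = icopyI addr₀ save₀
  choiceCode l a b 11 = icopyI addr₁ save₁
  choiceCode l a b 12 = icopyI save₀ bound
  choiceCode l a b 13 = icopyI save₁ bound
  choiceCode l a b 14 = goto (entry b)
  choiceCode l a b _  = stopI

  blockCode : Fin (suc (len M)) → Instr A (suc k) (suc (len M)) → ℕ → Ins′
  blockCode l (opI j i js)      0 = opI j i js
  blockCode l (constI j i)      0 = constI j i
  blockCode l (copyI j m)       0 = copyI j m
  blockCode l (icopyI j m)      0 = icopyI (emb j) (emb m)
  blockCode l (isetI j)         0 = isetI (emb j)
  blockCode l (iincI j)         0 = iincI (emb j)
  blockCode l (iincI j)         1 = ifIdxI (emb j) bound (blockAt l (# 2)) (blockAt l (# 5))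
  blockCode l (iincI j)         2 = bumpCode 0
  blockCode l (iincI j)         3 = bumpCode 1
  blockCode l (iincI j)         4 = bumpCode 2
  blockCode l (iincI j)         5 = goto (entry (nextLabel l))
  blockCode l (ifRelI i js a b) 0 = ifRelI i js (entry a) (entry b)
  blockCode l (ifIdxI j m a b)  0 = ifIdxI (emb j) (emb m) (entry a) (entry b)
  blockCode l (chooseI a b)     n = choiceCode l a b n
  blockCode l _                 1 = goto (entry (nextLabel l))
  blockCode l _                 _ = stopI

  -- The compiled code has no chooseI; filtering it out anyway makes IsNu M′ immediate.
  noChoice : Ins′ → Ins′
  noChoice (chooseI _ _) = stopI
  noChoice ins           = ins

  noChoice-isChoose : ∀ ins → isChoose (noChoice ins) ≡ false
  noChoice-isChoose (chooseI _ _)    = refl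
  noChoice-isChoose (opI _ _ _)      = refl
  noChoice-isChoose (constI _ _)     = refl
  noChoice-isChoose (copyI _ _)      = refl
  noChoice-isChoose (icopyI _ _)     = refl
  noChoice-isChoose (isetI _)        = refl
  noChoice-isChoose (iincI _)        = refl
  noChoice-isChoose (ifRelI _ _ _ _) = refl
  noChoice-isChoose (ifIdxI _ _ _ _) = refl
  noChoice-isChoose stopI            = refl
  noChoice-isChoose (nuI _ _)        = refl

  blockCodeAt : Fin (suc (len M)) × Fin 16 → Ins′
  blockCodeAt (l , r) = blockCode l (prog M l) (toℕ r)

  codeAfterPreamble : Fin (K * 3) ⊎ Fin (suc (len M) * 16) → Ins′
  codeAfterPreamble = [ bumpCode ∘ toℕ ∘ proj₂ ∘ remQuot {K} 3 , blockCodeAt ∘ remQuot {suc (len M)} 16 ]′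

  rawCode : Lab → Ins′
  rawCode L = [ preambleCode ∘ toℕ , codeAfterPreamble ∘ splitAt (K * 3) ]′ (splitAt 9 L)

  code : Lab → Ins′
  code = noChoice ∘ rawCode

  code-pre : ∀ a → code (pre a) ≡ noChoice (preambleCode (toℕ a))
  code-pre a = cong (λ s → noChoice ([ preambleCode ∘ toℕ , codeAfterPreamble ∘ splitAt (K * 3) ]′ s))
                    (Fin.splitAt-↑ˡ 9 a (K * 3 + suc (len M) * 16))

  code-bumpAt : ∀ t r → code (bumpAt t r) ≡ noChoice (bumpCode (toℕ r))
  code-bumpAt t r = trans (cong (noChoice ∘ codeAfterPreamble) (Fin.splitAt-↑ˡ (K * 3) (combine t r) (suc (len M) * 16)))
                          (cong (λ p → noChoice (bumpCode (toℕ (proj₂ p)))) (Fin.remQuot-combine {K} {3} t r))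

  code-blockAt : ∀ {l ins} → prog M l ≡ ins → ∀ r → code (blockAt l r) ≡ noChoice (blockCode l ins (toℕ r))
  code-blockAt {l} refl r =
    trans (cong (noChoice ∘ codeAfterPreamble) (Fin.splitAt-↑ʳ (K * 3) (suc (len M) * 16) (combine l r)))
          (cong (noChoice ∘ blockCodeAt) (Fin.remQuot-combine {suc (len M)} {16} l r))

  toℕ-bumpAt : ∀ t r → toℕ (bumpAt t r) ≡ 9 + (3 * toℕ t + toℕ r)
  toℕ-bumpAt t r = cong (9 +_) (trans (Fin.toℕ-↑ˡ (combine t r) _) (Fin.toℕ-combine t r))

  toℕ-blockAt : ∀ l r → toℕ (blockAt l r) ≡ 9 + (K * 3 + (16 * toℕ l + toℕ r))
  toℕ-blockAt l r = cong (9 +_) (trans (Fin.toℕ-↑ʳ (K * 3) (combine l r)) (cong (K * 3 +_) (Fin.toℕ-combine l r)))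

  pre-↦ : ∀ (a : Fin 8) → pre (inject₁ a) ↦ pre (suc a)
  pre-↦ a = mk↦ (trans (Fin.toℕ-↑ˡ (suc a) _)
                      (cong suc (sym (trans (Fin.toℕ-↑ˡ (inject₁ a) _) (Fin.toℕ-inject₁ a)))))

  bumpAt-↦ : ∀ t (r : Fin 2) → bumpAt t (inject₁ r) ↦ bumpAt t (suc r)
  bumpAt-↦ t r = mk↦ (begin
    toℕ (bumpAt t (suc r))               ≡⟨ toℕ-bumpAt t (suc r) ⟩
    9 + (3 * toℕ t + suc (toℕ r))         ≡⟨ cong (9 +_) (+-suc (3 * toℕ t) (toℕ r)) ⟩
    suc (9 + (3 * toℕ t + toℕ r))         ≡⟨ cong (λ x → suc (9 + (3 * toℕ t + x))) (Fin.toℕ-inject₁ r) ⟨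
    suc (9 + (3 * toℕ t + toℕ (inject₁ r))) ≡⟨ cong suc (toℕ-bumpAt t (inject₁ r)) ⟨
    suc (toℕ (bumpAt t (inject₁ r)))      ∎)
    where open ≡-Reasoning

  bumpAt-next-↦ : ∀ {t t′} → toℕ t′ ≡ suc (toℕ t) → bumpAt t (# 2) ↦ bumpAt t′ zero
  bumpAt-next-↦ {t} {t′} e = mk↦ (trans (toℕ-bumpAt t′ zero)
    (trans (cong (λ x → 9 + (3 * x + 0)) e) (trans (arith (toℕ t)) (cong suc (sym (toℕ-bumpAt t (# 2)))))))
    where arith : ∀ x → 9 + (3 * suc x + 0) ≡ suc (9 + (3 * x + 2))
          arith = solve-∀

  bumpAt-last-↦ : ∀ {t} → suc (toℕ t) ≡ K → bumpAt t (# 2) ↦ entry zero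
  bumpAt-last-↦ {t} e = mk↦ (trans (toℕ-blockAt zero zero)
    (trans (cong (λ x → 9 + (x * 3 + (16 * 0 + 0))) (sym e)) (trans (arith (toℕ t)) (cong suc (sym (toℕ-bumpAt t (# 2)))))))
    where arith : ∀ x → 9 + (suc x * 3 + (16 * 0 + 0)) ≡ suc (9 + (3 * x + 2))
          arith = solve-∀

  blockAt-↦ : ∀ l (r : Fin 15) → blockAt l (inject₁ r) ↦ blockAt l (suc r)
  blockAt-↦ l r = mk↦ (begin
    toℕ (blockAt l (suc r))                           ≡⟨ toℕ-blockAt l (suc r) ⟩
    9 + (K * 3 + (16 * toℕ l + suc (toℕ r)))          ≡⟨ cong (λ x → 9 + (K * 3 + x)) (+-suc (16 * toℕ l) (toℕ r)) ⟩
    9 + (K * 3 + suc (16 * toℕ l + toℕ r))            ≡⟨ cong (9 +_) (+-suc (K * 3) _) ⟩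
    suc (9 + (K * 3 + (16 * toℕ l + toℕ r)))          ≡⟨ cong (λ x → suc (9 + (K * 3 + (16 * toℕ l + x)))) (Fin.toℕ-inject₁ r) ⟨
    suc (9 + (K * 3 + (16 * toℕ l + toℕ (inject₁ r)))) ≡⟨ cong suc (toℕ-blockAt l (inject₁ r)) ⟨
    suc (toℕ (blockAt l (inject₁ r)))                 ∎)
    where open ≡-Reasoning

  last≡blockAt : fromℕ len′ ≡ blockAt (fromℕ (len M)) (# 15)
  last≡blockAt = Fin.toℕ-injective (begin
    toℕ (fromℕ len′)                               ≡⟨ Fin.toℕ-fromℕ len′ ⟩
    8 + (K * 3 + suc (len M) * 16)                 ≡⟨ arith (K * 3) (len M) ⟩
    9 + (K * 3 + (16 * len M + 15))                ≡⟨ cong (λ x → 9 + (K * 3 + (16 * x + 15))) (Fin.toℕ-fromℕ (len M)) ⟨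
    9 + (K * 3 + (16 * toℕ (fromℕ (len M)) + 15))   ≡⟨ toℕ-blockAt (fromℕ (len M)) (# 15) ⟨
    toℕ (blockAt (fromℕ (len M)) (# 15))           ∎)
    where open ≡-Reasoning
          arith : ∀ x n → 8 + (x + suc n * 16) ≡ 9 + (x + (16 * n + 15))
          arith = solve-∀

  M′ : Machine A
  M′ = record
    { nIdx     = k + 5
    ; len      = len′
    ; prog     = code
    ; lastStop = trans (cong code last≡blockAt) (code-blockAt (lastStop M) (# 15))
    }

  M′-isNu : IsNu M′
  M′-isNu L = noChoice-isChoose (rawCode L)

  nextLabel-≡ : ∀ {l l′} → l ↦ l′ → nextLabel l ≡ l′
  nextLabel-≡ {l} {l′} (mk↦ e) with suc (toℕ l) <? suc (len M)
  ... | yes l+1<n = Fin.toℕ-injective (trans (Fin.toℕ-fromℕ< l+1<n) (sym e))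
  ... | no l+1≮n  = contradiction (subst (_< suc (len M)) e (Fin.toℕ<n l′)) l+1≮n

  nextLabel-↦ : ∀ {l ins} → prog M l ≡ ins → ins ≢ stopI → l ↦ nextLabel l
  nextLabel-↦ {l} p ins≢stop with suc (toℕ l) <? suc (len M)
  ... | yes l+1<n = mk↦ (Fin.toℕ-fromℕ< l+1<n)
  ... | no l+1≮n  = contradiction (trans (sym p) (trans (cong (prog M) l≡last) (lastStop M))) ins≢stop
    where l≡last : l ≡ fromℕ (len M)
          l≡last = Fin.toℕ-injective (trans (≤-antisym (Fin.toℕ≤pred[n] l) (≮⇒≥ (l+1≮n ∘ s≤s)))
                                            (sym (Fin.toℕ-fromℕ (len M))))

  target<K : ∀ l → target (prog M l) < K
  target<K l = s≤s (m≤n⇒m≤1+n (tabulate⁻ {f = target ∘ prog M} (xs≤max 0 (L.tabulate (target ∘ prog M))) l))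

  emb≢extra : ∀ {j i} → emb j ≢ extra i
  emb≢extra {j} {i} e
    with trans (sym (Fin.splitAt-↑ˡ (suc k) j 5)) (trans (cong (splitAt (suc k)) e) (Fin.splitAt-↑ʳ (suc k) 5 i))
  ... | ()

  extra-≢ : ∀ {a b} → a ≢ b → extra a ≢ extra b
  extra-≢ {a} {b} a≢b = a≢b ∘ Fin.↑ʳ-injective (suc k) a b

  emb-injective : ∀ {j m} → emb j ≡ emb m → j ≡ m
  emb-injective {j} {m} = Fin.↑ˡ-injective 5 j m

  bump : (Idx → ℕ) → Idx → ℕ
  bump I = incr (incr (incr I bound) save₀) save₁

  bump-others : ∀ I {m} → m ≢ bound → m ≢ save₀ → m ≢ save₁ → bump I m ≡ I m
  bump-others I {m} m≢b m≢s₀ m≢s₁ = begin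
    bump I m                         ≡⟨ updI-minimal (incr (incr I bound) save₀) save₁ _ m≢s₁ ⟩
    incr (incr I bound) save₀ m      ≡⟨ updI-minimal (incr I bound) save₀ _ m≢s₀ ⟩
    incr I bound m                   ≡⟨ updI-minimal I bound _ m≢b ⟩
    I m                              ∎
    where open ≡-Reasoning

  bump-emb : ∀ I j → bump I (emb j) ≡ I (emb j)
  bump-emb I j = bump-others I emb≢extra emb≢extra emb≢extra

  bump-bound : ∀ I → bump I bound ≡ suc (I bound)
  bump-bound I = begin
    bump I bound                     ≡⟨ updI-minimal (incr (incr I bound) save₀) save₁ _ (extra-≢ λ ()) ⟩
    incr (incr I bound) save₀ bound  ≡⟨ updI-minimal (incr I bound) save₀ _ (extra-≢ λ ()) ⟩
    incr I bound bound               ≡⟨ updI-updates I bound _ ⟩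
    suc (I bound)                    ∎
    where open ≡-Reasoning

  bump-save₀ : ∀ I → bump I save₀ ≡ suc (I save₀)
  bump-save₀ I = begin
    bump I save₀                     ≡⟨ updI-minimal (incr (incr I bound) save₀) save₁ _ (extra-≢ λ ()) ⟩
    incr (incr I bound) save₀ save₀  ≡⟨ updI-updates (incr I bound) save₀ _ ⟩
    suc (incr I bound save₀)         ≡⟨ cong suc (updI-minimal I bound _ (extra-≢ λ ())) ⟩
    suc (I save₀)                    ∎
    where open ≡-Reasoning

  bump-save₁ : ∀ I → bump I save₁ ≡ suc (I save₁)
  bump-save₁ I = begin
    bump I save₁                              ≡⟨ updI-updates (incr (incr I bound) save₀) save₁ _ ⟩
    suc (incr (incr I bound) save₀ save₁)     ≡⟨ cong suc (updI-minimal (incr I bound) save₀ _ (extra-≢ λ ())) ⟩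
    suc (incr I bound save₁)                  ≡⟨ cong suc (updI-minimal I bound _ (extra-≢ λ ())) ⟩
    suc (I save₁)                             ∎
    where open ≡-Reasoning

  record Layout (I : Idx → ℕ) : Set where
    field
      save₀≡ : I save₀ ≡ 1 + I bound
      save₁≡ : I save₁ ≡ 2 + I bound
      addr₀≡ : I addr₀ ≡ 0
      addr₁≡ : I addr₁ ≡ 1

  Layout-extra : ∀ {I I′} → (∀ i → I′ (extra i) ≡ I (extra i)) → Layout I → Layout I′
  Layout-extra {I} {I′} same layout = record
    { save₀≡ = trans (same _) (trans save₀≡ (cong suc (sym (same _))))
    ; save₁≡ = trans (same _) (trans save₁≡ (cong (2 +_) (sym (same _))))
    ; addr₀≡ = trans (same _) addr₀≡
    ; addr₁≡ = trans (same _) addr₁≡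
    }
    where open Layout layout

  Layout-updI : ∀ {I} j v → Layout I → Layout (updI I (emb j) v)
  Layout-updI {I} j v = Layout-extra λ i → updI-minimal I (emb j) v (emb≢extra ∘ sym)

  Layout-bump : ∀ {I} → Layout I → Layout (bump I)
  Layout-bump {I} layout = record
    { save₀≡ = trans (bump-save₀ I) (trans (cong suc save₀≡) (cong suc (sym (bump-bound I))))
    ; save₁≡ = trans (bump-save₁ I) (trans (cong suc save₁≡) (cong (2 +_) (sym (bump-bound I))))
    ; addr₀≡ = trans (bump-others I (extra-≢ λ ()) (extra-≢ λ ()) (extra-≢ λ ())) addr₀≡
    ; addr₁≡ = trans (bump-others I (extra-≢ λ ()) (extra-≢ λ ()) (extra-≢ λ ())) addr₁≡
    }
    where open Layout layout

  ConstantFrom : ℕ → (ℕ → U A) → Set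
  ConstantFrom p Z = ∀ m → p ≤ m → Z m ≡ Z p

  ConstantFrom-suc : ∀ {p Z} → ConstantFrom p Z → ConstantFrom (suc p) Z
  ConstantFrom-suc {p} const m p<m = trans (const m (<⇒≤ p<m)) (sym (const (suc p) (n≤1+n p)))

  record Invariant (Z : ℕ → U A) (I : Idx → ℕ) : Set where
    field
      layout    : Layout I
      K≤bound   : K ≤ I bound
      emb<bound : ∀ j → I (emb j) < I bound
      tail      : ConstantFrom (I bound) Z

  Invariant-upd : ∀ {Z I} j x → Invariant Z I → j < I bound → Invariant (upd Z j x) I
  Invariant-upd {Z} {I} j x inv j<bound = record
    { layout = layout ; K≤bound = K≤bound ; emb<bound = emb<bound
    ; tail   = λ m bound≤m → begin
        upd Z j x m         ≡⟨ upd-minimal Z j x (λ { refl → <⇒≱ j<bound bound≤m }) ⟩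
        Z m                 ≡⟨ tail m bound≤m ⟩
        Z (I bound)         ≡⟨ upd-minimal Z j x (>⇒≢ j<bound) ⟨
        upd Z j x (I bound) ∎
    }
    where open Invariant inv
          open ≡-Reasoning

  Invariant-≗ : ∀ {Z Z′ I} → Z ≗ Z′ → Invariant Z I → Invariant Z′ I
  Invariant-≗ {Z} {Z′} {I} Z≗Z′ inv = record
    { layout = layout ; K≤bound = K≤bound ; emb<bound = emb<bound
    ; tail   = λ m bound≤m → trans (sym (Z≗Z′ m)) (trans (tail m bound≤m) (Z≗Z′ (I bound)))
    }
    where open Invariant inv

  Invariant-updI : ∀ {Z I} j v → Invariant Z I → v < I bound → Invariant Z (updI I (emb j) v)
  Invariant-updI {Z} {I} j v inv v<bound = record
    { layout    = Layout-updI j v layout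
    ; K≤bound   = subst (K ≤_) (sym bound-same) K≤bound
    ; emb<bound = λ m → subst (updI I (emb j) v (emb m) <_) (sym bound-same) (below m)
    ; tail      = subst (λ p → ConstantFrom p Z) (sym bound-same) tail
    }
    where
      open Invariant inv
      bound-same : updI I (emb j) v bound ≡ I bound
      bound-same = updI-minimal I (emb j) v (emb≢extra ∘ sym)
      below : ∀ m → updI I (emb j) v (emb m) < I bound
      below m with m Fin.≟ j
      ... | yes refl = subst (_< I bound) (sym (updI-updates I (emb m) v)) v<bound
      ... | no m≢j   = subst (_< I bound) (sym (updI-minimal I (emb j) v (m≢j ∘ emb-injective))) (emb<bound m)

  Invariant-bump : ∀ {Z I} → Layout I → K ≤ I bound → (∀ j → I (emb j) ≤ I bound) → ConstantFrom (I bound) Z →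
                   Invariant Z (bump I)
  Invariant-bump {Z} {I} layout K≤bound emb≤bound tail = record
    { layout    = Layout-bump layout
    ; K≤bound   = subst (K ≤_) (sym (bump-bound I)) (m≤n⇒m≤1+n K≤bound)
    ; emb<bound = λ j → subst₂ _<_ (sym (bump-emb I j)) (sym (bump-bound I)) (s≤s (emb≤bound j))
    ; tail      = subst (λ p → ConstantFrom p Z) (sym (bump-bound I)) (ConstantFrom-suc tail)
    }


  updI-emb : ∀ {I′ : Idx → ℕ} {I : Fin (suc k) → ℕ} → (∀ m → I′ (emb m) ≡ I m) →
             ∀ j v m → updI I′ (emb j) v (emb m) ≡ updI I j v m
  updI-emb {I′} {I} I≡ j v m with m Fin.≟ j
  ... | yes refl = trans (updI-updates I′ (emb m) v) (sym (updI-updates I m v))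
  ... | no m≢j   = trans (updI-minimal I′ (emb j) v (m≢j ∘ emb-injective)) (trans (I≡ m) (sym (updI-minimal I j v m≢j)))

  Invariant-incr : ∀ {Z I} j → Invariant Z I → suc (I (emb j)) ≢ I bound → Invariant Z (incr I (emb j))
  Invariant-incr j inv miss = Invariant-updI j _ inv (≤∧≢⇒< (Invariant.emb<bound inv j) miss)

  Invariant-incr-bump : ∀ {Z I} j → Invariant Z I → suc (I (emb j)) ≡ I bound → Invariant Z (bump (incr I (emb j)))
  Invariant-incr-bump {Z} {I} j inv hit =
    Invariant-bump (Layout-updI j _ layout) (subst (K ≤_) (sym bound-same) K≤bound) emb≤bound
                   (subst (λ p → ConstantFrom p Z) (sym bound-same) tail)
    where
      open Invariant inv
      bound-same : incr I (emb j) bound ≡ I bound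
      bound-same = updI-minimal I (emb j) _ (emb≢extra ∘ sym)
      emb≤bound : ∀ m → incr I (emb j) (emb m) ≤ incr I (emb j) bound
      emb≤bound m with m Fin.≟ j
      ... | yes refl = ≤-reflexive (trans (updI-updates I (emb m) _) (trans hit (sym bound-same)))
      ... | no m≢j   =
        subst₂ _≤_ (sym (updI-minimal I (emb j) _ (m≢j ∘ emb-injective))) (sym bound-same) (<⇒≤ (emb<bound m))

  Invariant-unprobe : ∀ {Z I} → Invariant Z I → ∀ y c →
    unprobe (probe Z (I save₀) (I save₁) (I addr₀) (I addr₁) y c)
            (I save₀) (I save₁) (I addr₀) (I addr₁) (I bound) ≗ Z
  Invariant-unprobe {Z} {I} inv y c
    rewrite Layout.save₀≡ (Invariant.layout inv) | Layout.save₁≡ (Invariant.layout inv)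
          | Layout.addr₀≡ (Invariant.layout inv) | Layout.addr₁≡ (Invariant.layout inv) =
    unprobe-probe Z (I bound) y c (≤-trans (s≤s (s≤s z≤n)) K≤bound)
                  (tail _ (n≤1+n _)) (tail _ (≤-trans (n≤1+n _) (n≤1+n _)))
    where open Invariant inv

  record Setup (n p : ℕ) (I : Idx → ℕ) : Set where
    field
      layout : Layout I
      bound≡ : I bound ≡ p
      emb≡   : ∀ j → I (emb j) ≡ initI n j

  Setup-bump : ∀ {n p I} → Setup n p I → Setup n (suc p) (bump I)
  Setup-bump {I = I} setup = record
    { layout = Layout-bump layout
    ; bound≡ = trans (bump-bound I) (cong suc bound≡)
    ; emb≡   = λ j → trans (bump-emb I j) (emb≡ j)
    }
    where open Setup setup

  start : ℕ → Idx → ℕ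
  start n = incr (incr (incr (incr (initI n) save₀) save₁) save₁) addr₁

  Setup-start : ∀ n → Setup n 0 (start n)
  Setup-start n = record
    { layout = record
      { save₀≡ = trans at-save₀ (cong suc (sym at-bound))
      ; save₁≡ = trans at-save₁ (cong (2 +_) (sym at-bound))
      ; addr₀≡ = untouched (extra-≢ λ ()) (extra-≢ λ ()) (extra-≢ λ ())
      ; addr₁≡ = trans (updI-updates I₃ addr₁ _) (cong suc (untouched′ (extra-≢ λ ()) (extra-≢ λ ())))
      }
    ; bound≡ = at-bound
    ; emb≡   = λ j → trans (untouched emb≢extra emb≢extra emb≢extra) (initI-emb j)
    }
    where
      I₀ I₁ I₂ I₃ : Idx → ℕ
      I₀ = initI n
      I₁ = incr I₀ save₀
      I₂ = incr I₁ save₁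
      I₃ = incr I₂ save₁
      untouched′ : ∀ {m} → m ≢ save₀ → m ≢ save₁ → I₃ m ≡ I₀ m
      untouched′ m≢s₀ m≢s₁ =
        trans (updI-minimal I₂ save₁ _ m≢s₁) (trans (updI-minimal I₁ save₁ _ m≢s₁) (updI-minimal I₀ save₀ _ m≢s₀))
      untouched : ∀ {m} → m ≢ save₀ → m ≢ save₁ → m ≢ addr₁ → start n m ≡ I₀ m
      untouched m≢s₀ m≢s₁ m≢a₁ = trans (updI-minimal I₃ addr₁ _ m≢a₁) (untouched′ m≢s₀ m≢s₁)
      at-bound : start n bound ≡ 0
      at-bound = untouched (extra-≢ λ ()) (extra-≢ λ ()) (extra-≢ λ ())
      at-save₀ : start n save₀ ≡ 1
      at-save₀ = trans (updI-minimal I₃ addr₁ _ (extra-≢ λ ()))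
                 (trans (updI-minimal I₂ save₁ _ (extra-≢ λ ()))
                 (trans (updI-minimal I₁ save₁ _ (extra-≢ λ ())) (updI-updates I₀ save₀ _)))
      at-save₁ : start n save₁ ≡ 2
      at-save₁ = trans (updI-minimal I₃ addr₁ _ (extra-≢ λ ()))
                 (trans (updI-updates I₂ save₁ _)
                 (cong suc (trans (updI-updates I₁ save₁ _) (cong suc (updI-minimal I₀ save₀ _ (extra-≢ λ ()))))))
      initI-emb : ∀ j → initI {k + 5} n (emb j) ≡ initI n j
      initI-emb zero    = refl
      initI-emb (suc j) = refl

  module Correctness (i₂ : Fin (nConst A)) (c₁≢c₂ : const A i₁ ≢ const A i₂)
    (eqRel-spec : ∀ a b → rel A eqRel (subst (Vec (U A)) (sym eqRel-arity) (a ∷ b ∷ [])) ⇔ (a ≡ b))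
    (M-isNDB : IsNDB M) where

    c₁ c₂ : U A
    c₁ = const A i₁
    c₂ = const A i₂

    Q′ : U A ^∞ → Set
    Q′ = PairInf c₁ c₂

    module S = Semantics M (λ _ → ⊥)
    open Semantics M′ Q′

    enter : Fin (suc (len M)) → (ℕ → U A) → (Idx → ℕ) → Conf
    enter l = cfg (entry l)

    record Sim (Z : ℕ → U A) (I : Fin (suc k) → ℕ) (Z′ : ℕ → U A) (I′ : Idx → ℕ) : Set where
      field
        Z≗        : Z ≗ Z′
        I≡        : ∀ j → I′ (emb j) ≡ I j
        invariant : Invariant Z′ I′

    Sim-upd : ∀ {Z I Z′ I′ j j′ x x′} → Sim Z I Z′ I′ → j′ ≡ j → j′ < I′ bound → x ≡ x′ →
              Sim (upd Z j x) I (upd Z′ j′ x′) I′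
    Sim-upd {j = j} sim refl j<bound x≡x′ = record
      { Z≗ = upd-cong j x≡x′ Z≗ ; I≡ = I≡ ; invariant = Invariant-upd j _ invariant j<bound }
      where open Sim sim

    Sim-updI : ∀ {Z I Z′ I′} j {v} → Sim Z I Z′ I′ → v < I′ bound → Sim Z (updI I j v) Z′ (updI I′ (emb j) v)
    Sim-updI {I = I} {I′ = I′} j {v} sim v<bound = record
      { Z≗ = Z≗ ; I≡ = updI-emb {I′} {I} I≡ j v ; invariant = Invariant-updI j v invariant v<bound }
      where open Sim sim

    output-sim : ∀ {l : S.Label} {Z I Z′ I′} {L : Label} → Sim Z I Z′ I′ →
                 output {A} (cfg l Z I) ≡ output {A} (cfg L Z′ I′)
    output-sim {Z = Z} {Z′ = Z′} sim = pair-≡ (sym (I≡ zero))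
      where
        open Sim sim
        pair-≡ : ∀ {n n′} → n ≡ n′ →
                 _≡_ {A = U A ^∞} (n , V.tabulate (Z ∘ toℕ)) (n′ , V.tabulate (Z′ ∘ toℕ))
        pair-≡ refl = cong (_ ,_) (V.tabulate-cong (Z≗ ∘ toℕ))

    halted-enter : ∀ {l} → prog M l ≡ stopI → code (entry l) ≡ stopI
    halted-enter h = code-blockAt h zero

    goto⇀ : ∀ {L T Z′ I′} → code L ≡ goto T → ForcedStep (cfg L Z′ I′) (cfg T Z′ I′)
    goto⇀ p = ifIdx-yes⇀ p refl

    next⇀ : ∀ {L l l′ Z′ I′} → code L ≡ goto (entry (nextLabel l)) → l ↦ l′ →
            ForcedStep (cfg L Z′ I′) (enter l′ Z′ I′)
    next⇀ p e = subst (λ t → ForcedStep _ (enter t _ _)) (nextLabel-≡ e) (goto⇀ p)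

    bump⇛ : ∀ {L₀ L₁ L₂ L₃ Z′ I′} → code L₀ ≡ iincI bound → code L₁ ≡ iincI save₀ → code L₂ ≡ iincI save₁ →
            L₀ ↦ L₁ → L₁ ↦ L₂ → L₂ ↦ L₃ → cfg L₀ Z′ I′ ⇛ cfg L₃ Z′ (bump I′)
    bump⇛ p₀ p₁ p₂ e₁ e₂ e₃ = iinc⇀ p₀ e₁ ∷ iinc⇀ p₁ e₂ ∷ [ iinc⇀ p₂ e₃ ]

    target<bound : ∀ {l ins Z′ I′} → Invariant Z′ I′ → prog M l ≡ ins → target ins < I′ bound
    target<bound {l} inv p = <-≤-trans (subst (λ ins → target ins < K) p (target<K l)) (Invariant.K≤bound inv)

    Simulated⇛ : S.Conf → (ℕ → U A) → (Idx → ℕ) → S.Conf → Set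
    Simulated⇛ c Z′ I′ d = ∃₂ λ Z″ I″ → enter (label c) Z′ I′ ⇛ enter (label d) Z″ I″ × Sim (Z d) (I d) Z″ I″

    module _ {l Z I Z′ I′ j l′} (sim : Sim Z I Z′ I′) (p : prog M l ≡ iincI j) (e : l ↦ l′) where
      open Sim sim

      private
        bound-same : incr I′ (emb j) bound ≡ I′ bound
        bound-same = updI-minimal I′ (emb j) _ (emb≢extra ∘ sym)

        incr-emb : ∀ m → incr I′ (emb j) (emb m) ≡ incr I j m
        incr-emb m = trans (updI-emb {I′} {I} I≡ j (suc (I′ (emb j))) m) (cong (λ v → updI I j (suc v) m) (I≡ j))

      simulate-iinc-miss : suc (I′ (emb j)) ≢ I′ bound → Simulated⇛ (cfg l Z I) Z′ I′ (cfg l′ Z (incr I j))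
      simulate-iinc-miss miss = _ , _ ,
        iinc⇀ (code-blockAt p zero) (blockAt-↦ l zero) ∷
        ifIdx-no⇀ (code-blockAt p (# 1))
                  (λ q → miss (trans (sym (updI-updates I′ (emb j) (suc (I′ (emb j))))) (trans q bound-same))) ∷
        [ next⇀ (code-blockAt p (# 5)) e ] ,
        record { Z≗ = Z≗ ; I≡ = incr-emb ; invariant = Invariant-incr j invariant miss }

      simulate-iinc-hit : suc (I′ (emb j)) ≡ I′ bound → Simulated⇛ (cfg l Z I) Z′ I′ (cfg l′ Z (incr I j))
      simulate-iinc-hit hit = _ , _ ,
        iinc⇀ (code-blockAt p zero) (blockAt-↦ l zero) ∷
        ifIdx-yes⇀ (code-blockAt p (# 1)) (trans (updI-updates I′ (emb j) (suc (I′ (emb j)))) (trans hit (sym bound-same))) ∷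
        (bump⇛ (code-blockAt p (# 2)) (code-blockAt p (# 3)) (code-blockAt p (# 4))
               (blockAt-↦ l (# 2)) (blockAt-↦ l (# 3)) (blockAt-↦ l (# 4)) ++
         [ next⇀ (code-blockAt p (# 5)) e ]) ,
        record { Z≗ = Z≗ ; I≡ = λ m → trans (bump-emb (incr I′ (emb j)) m) (incr-emb m)
               ; invariant = Invariant-incr-bump j invariant hit }

    choice-excluded : ∀ {l a b} → isChoose (prog M l) ≡ false → prog M l ≢ chooseI a b
    choice-excluded nc p with trans (sym (cong isChoose p)) nc
    ... | ()

    simulate : ∀ {c d Z′ I′} → Sim (Z c) (I c) Z′ I′ → isChoose (prog M (label c)) ≡ false → c S.⟶ d →
               Simulated⇛ c Z′ I′ d
    simulate {cfg l Z I} sim nc (st-op {j = j} {i} {js} p l′ e) = _ , _ ,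
      op⇀ (code-blockAt p zero) (blockAt-↦ l zero) ∷ [ next⇀ (code-blockAt p (# 1)) (mk↦ e) ] ,
      Sim-upd sim refl (target<bound invariant p) (cong (op A i) (V.map-cong Z≗ js))
      where open Sim sim
    simulate {cfg l Z I} sim nc (st-const p l′ e) = _ , _ ,
      const⇀ (code-blockAt p zero) (blockAt-↦ l zero) ∷ [ next⇀ (code-blockAt p (# 1)) (mk↦ e) ] ,
      Sim-upd sim refl (target<bound (Sim.invariant sim) p) refl
    simulate {cfg l Z I} sim nc (st-copy {m = m} p l′ e) = _ , _ ,
      copy⇀ (code-blockAt p zero) (blockAt-↦ l zero) ∷ [ next⇀ (code-blockAt p (# 1)) (mk↦ e) ] ,
      Sim-upd sim refl (target<bound invariant p) (Z≗ m)
      where open Sim sim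
    simulate {cfg l Z I} {Z′ = Z′} sim nc (st-icopy {j = j} {m} p l′ e) = _ , _ ,
      icopy⇀ (code-blockAt p zero) (blockAt-↦ l zero) ∷ [ next⇀ (code-blockAt p (# 1)) (mk↦ e) ] ,
      Sim-upd sim (I≡ j) (Invariant.emb<bound invariant j) (trans (Z≗ (I m)) (cong Z′ (sym (I≡ m))))
      where open Sim sim
    simulate {cfg l Z I} sim nc (st-iset {j = j} p l′ e) = _ , _ ,
      iset⇀ (code-blockAt p zero) (blockAt-↦ l zero) ∷ [ next⇀ (code-blockAt p (# 1)) (mk↦ e) ] ,
      Sim-updI j sim (<-≤-trans (s≤s z≤n) (Invariant.K≤bound (Sim.invariant sim)))
    simulate {I′ = I′} sim nc (st-iinc {j = j} p l′ e) =
      [ simulate-iinc-hit sim p (mk↦ e) , simulate-iinc-miss sim p (mk↦ e) ]′ (toSum (suc (I′ (emb j)) ≟ I′ bound))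
    simulate {cfg l Z I} sim nc (st-ifRelYes {i = i} {js} p r) = _ , _ ,
      [ ifRel-yes⇀ (code-blockAt p zero) (subst (rel A i) (V.map-cong Z≗ js) r) ] , sim
      where open Sim sim
    simulate {cfg l Z I} sim nc (st-ifRelNo {i = i} {js} p ¬r) = _ , _ ,
      [ ifRel-no⇀ (code-blockAt p zero) (¬r ∘ subst (rel A i) (sym (V.map-cong Z≗ js))) ] , sim
      where open Sim sim
    simulate {cfg l Z I} sim nc (st-ifIdxYes {j = j} {m} p eq) = _ , _ ,
      [ ifIdx-yes⇀ (code-blockAt p zero) (trans (I≡ j) (trans eq (sym (I≡ m)))) ] , sim
      where open Sim sim
    simulate {cfg l Z I} sim nc (st-ifIdxNo {j = j} {m} p ≢) = _ , _ ,
      [ ifIdx-no⇀ (code-blockAt p zero) (λ eq → ≢ (trans (sym (I≡ j)) (trans eq (I≡ m)))) ] , sim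
      where open Sim sim
    simulate sim nc (st-choose₁ p) = contradiction p (choice-excluded nc)
    simulate sim nc (st-choose₂ p) = contradiction p (choice-excluded nc)
    simulate sim nc (st-nu p y () l′ e)

    regs01-test : ∀ (W : ℕ → U A) → rel A eqRel (V.map W regs01) ⇔ (W 0 ≡ W 1)
    regs01-test W = subst (λ v → rel A eqRel v ⇔ (W 0 ≡ W 1)) (sym (map-regs eqRel-arity)) (eqRel-spec (W 0) (W 1))
      where map-regs : ∀ {n} (p : n ≡ 2) →
                       V.map W (subst (Vec ℕ) (sym p) (0 ∷ 1 ∷ [])) ≡ subst (Vec (U A)) (sym p) (W 0 ∷ W 1 ∷ [])
            map-regs refl = refl

    module Choice {l a b} (p : prog M l ≡ chooseI a b) {Z′ : ℕ → U A} {I′ : Idx → ℕ} where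

      saved : ℕ → U A
      saved = copyAt (copyAt Z′ (I′ save₀) (I′ addr₀)) (I′ save₁) (I′ addr₁)

      probed restored : U A → ℕ → U A
      probed y   = probe Z′ (I′ save₀) (I′ save₁) (I′ addr₀) (I′ addr₁) y c₁
      restored y = unprobe (probed y) (I′ save₀) (I′ save₁) (I′ addr₀) (I′ addr₁) (I′ bound)

      save⇛ : enter l Z′ I′ ⇛ cfg (blockAt l (# 2)) saved I′
      save⇛ = icopy⇀ (code-blockAt p zero) (blockAt-↦ l zero) ∷ [ icopy⇀ (code-blockAt p (# 1)) (blockAt-↦ l (# 1)) ]

      query : ∀ {y} → y ≡ c₁ ⊎ y ≡ c₂ → cfg (blockAt l (# 2)) saved I′ ⟶ cfg (blockAt l (# 3)) (upd saved 0 y) I′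
      query y∈ = st-nu (code-blockAt p (# 2)) _ (y∈ VAll.∷ VAll.[]) _ (toℕ-suc (blockAt-↦ l (# 2)))

      query-inv : ∀ {d} → cfg (blockAt l (# 2)) saved I′ ⟶ d →
                  ∃ λ y → (y ≡ c₁ ⊎ y ≡ c₂) × d ≡ cfg (blockAt l (# 3)) (upd saved 0 y) I′
      query-inv s = answer (effect-at (code-blockAt p (# 2)) s)
        where answer : ∀ {d} → Effect (nuI 0 L.[]) (cfg (blockAt l (# 2)) saved I′) d →
                       ∃ λ y → (y ≡ c₁ ⊎ y ≡ c₂) × d ≡ cfg (blockAt l (# 3)) (upd saved 0 y) I′
              answer (y , y∈ VAll.∷ VAll.[] , advance) = y , y∈ , advance-to advance (blockAt-↦ l (# 2))

      probed-0 : ∀ y → probed y 0 ≡ y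
      probed-0 y = trans (upd-minimal (upd saved 0 y) 1 c₁ {0} λ ()) (upd-updates saved 0 y)

      probed-1 : ∀ y → probed y 1 ≡ c₁
      probed-1 y = upd-updates (upd saved 0 y) 1 c₁

      resume-yes : cfg (blockAt l (# 3)) (upd saved 0 c₁) I′ ⇛ enter a (restored c₁) I′
      resume-yes =
        const⇀ (code-blockAt p (# 3)) (blockAt-↦ l (# 3)) ∷
        ifRel-yes⇀ (code-blockAt p (# 4))
                   (Equivalence.from (regs01-test (probed c₁)) (trans (probed-0 c₁) (sym (probed-1 c₁)))) ∷
        icopy⇀ (code-blockAt p (# 5)) (blockAt-↦ l (# 5)) ∷
        icopy⇀ (code-blockAt p (# 6)) (blockAt-↦ l (# 6)) ∷
        icopy⇀ (code-blockAt p (# 7)) (blockAt-↦ l (# 7)) ∷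
        icopy⇀ (code-blockAt p (# 8)) (blockAt-↦ l (# 8)) ∷
        [ goto⇀ (code-blockAt p (# 9)) ]

      resume-no : ∀ {y} → y ≢ c₁ → cfg (blockAt l (# 3)) (upd saved 0 y) I′ ⇛ enter b (restored y) I′
      resume-no {y} y≢c₁ =
        const⇀ (code-blockAt p (# 3)) (blockAt-↦ l (# 3)) ∷
        ifRel-no⇀ (code-blockAt p (# 4))
                  (λ r → y≢c₁ (trans (sym (probed-0 y)) (trans (Equivalence.to (regs01-test (probed y)) r) (probed-1 y)))) ∷
        icopy⇀ (code-blockAt p (# 10)) (blockAt-↦ l (# 10)) ∷
        icopy⇀ (code-blockAt p (# 11)) (blockAt-↦ l (# 11)) ∷
        icopy⇀ (code-blockAt p (# 12)) (blockAt-↦ l (# 12)) ∷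
        icopy⇀ (code-blockAt p (# 13)) (blockAt-↦ l (# 13)) ∷
        [ goto⇀ (code-blockAt p (# 14)) ]

      Sim-restored : ∀ {Z I} → Sim Z I Z′ I′ → ∀ y → Sim Z I (restored y) I′
      Sim-restored sim y = record
        { Z≗ = λ m → trans (Z≗ m) (sym (restored≗ m))
        ; I≡ = I≡
        ; invariant = Invariant-≗ (sym ∘ restored≗) invariant
        }
        where open Sim sim
              restored≗ : restored y ≗ Z′
              restored≗ = Invariant-unprobe invariant y c₁

    Simulated⟶* : S.Conf → (ℕ → U A) → (Idx → ℕ) → S.Conf → Set
    Simulated⟶* c Z′ I′ d = ∃₂ λ Z″ I″ → enter (label c) Z′ I′ ⟶* enter (label d) Z″ I″ × Sim (Z d) (I d) Z″ I″

    record Reflected (c : S.Conf) {c′ e′ : Conf} (r : c′ ⟶* e′) : Set where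
      field
        {next}        : S.Conf
        {next-Z}      : ℕ → U A
        {next-I}      : Idx → ℕ
        step          : c S.⟶ next
        sim           : Sim (Z next) (I next) next-Z next-I
        rest          : enter (label next) next-Z next-I ⟶* e′
        rest<r        : steps rest < steps r

    simulate-choice : ∀ {l a b Z I Z′ I′ d} → Sim Z I Z′ I′ → prog M l ≡ chooseI a b → cfg l Z I S.⟶ d →
                      Simulated⟶* (cfg l Z I) Z′ I′ d
    simulate-choice {l} {a} {b} {Z} {I} {Z′} {I′} sim p s = by-branch (S.effect-at p s)
      where
        open Choice p {Z′} {I′}
        by-branch : ∀ {d} → S.Effect (chooseI a b) (cfg l Z I) d → Simulated⟶* (cfg l Z I) Z′ I′ d
        by-branch (inj₁ refl) =
          _ , _ , ⇛⇒⟶* save⇛ ◅◅ query (inj₁ refl) ◅ ⇛⇒⟶* resume-yes , Sim-restored sim c₁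
        by-branch (inj₂ refl) =
          _ , _ , ⇛⇒⟶* save⇛ ◅◅ query (inj₂ refl) ◅ ⇛⇒⟶* (resume-no (c₁≢c₂ ∘ sym)) , Sim-restored sim c₂

    reflect-choice : ∀ {l a b Z I Z′ I′ e′} → Sim Z I Z′ I′ → prog M l ≡ chooseI a b → Halted e′ →
                     (r : enter l Z′ I′ ⟶* e′) → Reflected (cfg l Z I) r
    reflect-choice {l} {a} {b} {Z} {I} {Z′} {I′} {e′} sim p h r =
      let r₁ , r₁<r          = ⇛-suffix save⇛ h r
          _ , s , r₂ , r₂<r₁ = first-step querying h r₁
      in answered (query-inv s) r₂ (<-trans r₂<r₁ r₁<r)
      where
        open Choice p {Z′} {I′}
        querying : ¬ Halted (cfg (blockAt l (# 2)) saved I′)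
        querying h′ = contradiction (trans (sym (code-blockAt p (# 2))) h′) λ ()
        resumed : ∀ {y} → y ≡ c₁ ⊎ y ≡ c₂ → (r₂ : cfg (blockAt l (# 3)) (upd saved 0 y) I′ ⟶* e′) →
                  steps r₂ < steps r →
                  Reflected (cfg l Z I) r
        resumed (inj₁ refl) r₂ r₂<r = let r₃ , r₃<r₂ = ⇛-suffix resume-yes h r₂ in
          record { step = st-choose₁ p ; sim = Sim-restored sim c₁ ; rest = r₃ ; rest<r = <-trans r₃<r₂ r₂<r }
        resumed (inj₂ refl) r₂ r₂<r = let r₃ , r₃<r₂ = ⇛-suffix (resume-no (c₁≢c₂ ∘ sym)) h r₂ in
          record { step = st-choose₂ p ; sim = Sim-restored sim c₂ ; rest = r₃ ; rest<r = <-trans r₃<r₂ r₂<r }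
        answered : ∀ {d} → (∃ λ y → (y ≡ c₁ ⊎ y ≡ c₂) × d ≡ cfg (blockAt l (# 3)) (upd saved 0 y) I′) →
                   (r₂ : d ⟶* e′) → steps r₂ < steps r → Reflected (cfg l Z I) r
        answered (_ , y∈ , refl) = resumed y∈

    reflect-forced : ∀ {l Z I Z′ I′ e′ d} → Sim Z I Z′ I′ → isChoose (prog M l) ≡ false → Halted e′ →
                     (r : enter l Z′ I′ ⟶* e′) → cfg l Z I S.⟶ d → Reflected (cfg l Z I) r
    reflect-forced sim nc h r s =
      let _ , _ , f , sim′ = simulate sim nc s
          r′ , r′<r        = ⇛-suffix f h r
      in record { step = s ; sim = sim′ ; rest = r′ ; rest<r = r′<r }

    ifRel-step : ∀ {l i js a b Z I Z′ I′ e′} → Sim Z I Z′ I′ → prog M l ≡ ifRelI i js a b → Halted e′ →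
                 enter l Z′ I′ ⟶* e′ → ∃ λ d → cfg l Z I S.⟶ d
    ifRel-step {l} {i} {js} {a} {b} {Z} {I} {Z′} {I′} sim p h r =
      let _ , s′ , _ = first-step (λ h′ → contradiction (trans (sym (code-blockAt p zero)) h′) λ ()) h r
      in branch (effect-at (code-blockAt p zero) s′)
      where
        open Sim sim
        branch : ∀ {d′} → Effect (ifRelI i js (entry a) (entry b)) (enter l Z′ I′) d′ → ∃ λ d → cfg l Z I S.⟶ d
        branch (inj₁ (r′ , _))  = _ , st-ifRelYes p (subst (rel A i) (sym (V.map-cong Z≗ js)) r′)
        branch (inj₂ (¬r′ , _)) = _ , st-ifRelNo p (¬r′ ∘ subst (rel A i) (V.map-cong Z≗ js))

    reflect : ∀ {l : S.Label} {Z I Z′ I′ e′} → Sim Z I Z′ I′ → (r : enter l Z′ I′ ⟶* e′) → Halted e′ →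
              (S.Halted (cfg l Z I) × output {A} (cfg l Z I) ≡ output e′) ⊎ Reflected (cfg l Z I) r
    reflect {l} {Z} {I} {Z′} {I′} {e′} sim r h = by-instruction (prog M l) refl
      where
        Result : Set
        Result = (S.Halted (cfg l Z I) × output {A} (cfg l Z I) ≡ output e′) ⊎ Reflected (cfg l Z I) r
        forced-step : ∀ {ins d} → prog M l ≡ ins → isChoose ins ≡ false → cfg l Z I S.⟶ d → Result
        forced-step p nc s = inj₂ (reflect-forced sim (trans (cong isChoose p) nc) h r s)
        by-instruction : ∀ ins → prog M l ≡ ins → Result
        by-instruction stopI            p =
          inj₁ (p , trans (output-sim {l = l} {L = entry l} sim) (cong (output {A}) (halted-run (halted-enter p) r)))
        by-instruction (nuI _ _)        p = contradiction (trans (sym (cong isNu p)) (M-isNDB l)) λ ()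
        by-instruction (chooseI a b)    p = inj₂ (reflect-choice sim p h r)
        by-instruction (opI j i js)     p = forced-step p refl (st-op p _ (toℕ-suc (nextLabel-↦ p λ ())))
        by-instruction (constI j i)     p = forced-step p refl (st-const p _ (toℕ-suc (nextLabel-↦ p λ ())))
        by-instruction (copyI j m)      p = forced-step p refl (st-copy p _ (toℕ-suc (nextLabel-↦ p λ ())))
        by-instruction (icopyI j m)     p = forced-step p refl (st-icopy p _ (toℕ-suc (nextLabel-↦ p λ ())))
        by-instruction (isetI j)        p = forced-step p refl (st-iset p _ (toℕ-suc (nextLabel-↦ p λ ())))
        by-instruction (iincI j)        p = forced-step p refl (st-iinc p _ (toℕ-suc (nextLabel-↦ p λ ())))
        by-instruction (ifRelI i js a b) p = forced-step p refl (proj₂ (ifRel-step sim p h r))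
        by-instruction (ifIdxI j m a b) p =
          [ forced-step p refl ∘ st-ifIdxYes p , forced-step p refl ∘ st-ifIdxNo p ]′ (toSum (I j ≟ I m))

    forward-step : ∀ {c d Z′ I′} → Sim (Z c) (I c) Z′ I′ → c S.⟶ d → Simulated⟶* c Z′ I′ d
    forward-step {cfg l Z I} {d} {Z′} {I′} sim s = by-choice (isChoose (prog M l)) refl
      where
        by-choice : ∀ b → isChoose (prog M l) ≡ b → Simulated⟶* (cfg l Z I) Z′ I′ d
        by-choice false nc = let Z″ , I″ , f , sim′ = simulate sim nc s in Z″ , I″ , ⇛⇒⟶* f , sim′
        by-choice true  c  = let _ , _ , p = choice-view c in simulate-choice sim p s

    forward : ∀ {c d Z′ I′} → Sim (Z c) (I c) Z′ I′ → c S.⟶* d → Simulated⟶* c Z′ I′ d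
    forward sim ε       = _ , _ , ε , sim
    forward sim (s ◅ r) =
      let _ , _ , r₁ , sim₁ = forward-step sim s
          Z₂ , I₂ , r₂ , sim₂ = forward sim₁ r
      in Z₂ , I₂ , r₁ ◅◅ r₂ , sim₂

    backward : ∀ n {c Z′ I′ e′} → Sim (Z c) (I c) Z′ I′ → (r : enter (label c) Z′ I′ ⟶* e′) → steps r < n →
               Halted e′ →
               ∃ λ e → c S.⟶* e × S.Halted e × output e ≡ output e′
    backward (suc n) {c} {e′ = e′} sim r r<n h = [ stop , continue ]′ (reflect sim r h)
      where
        Result : Set
        Result = ∃ λ e → c S.⟶* e × S.Halted e × output e ≡ output e′
        stop : S.Halted c × output c ≡ output e′ → Result
        stop (h′ , out) = c , ε , h′ , out
        continue : Reflected c r → Result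
        continue ρ =
          let e , r′ , h′ , out = backward n (Reflected.sim ρ) (Reflected.rest ρ)
                                           (<-≤-trans (Reflected.rest<r ρ) (s≤s⁻¹ r<n)) h
          in e , Reflected.step ρ ◅ r′ , h′ , out

    start⇛ : ∀ {n Z′} → cfg (pre zero) Z′ (initI n) ⇛ cfg (pre (# 4)) Z′ (start n)
    start⇛ = iinc⇀ (code-pre zero) (pre-↦ zero) ∷ iinc⇀ (code-pre (# 1)) (pre-↦ (# 1)) ∷
             iinc⇀ (code-pre (# 2)) (pre-↦ (# 2)) ∷ [ iinc⇀ (code-pre (# 3)) (pre-↦ (# 3)) ]

    loop⇛ : ∀ u {n p I′ Z′} → p + u ≡ n → Setup n p I′ →
            ∃ λ I″ → Setup n n I″ × cfg (pre (# 4)) Z′ I′ ⇛ cfg (bumpAt zero zero) Z′ I″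
    loop⇛ zero {n} {p} {I′} p+0≡n setup =
      I′ , subst (λ q → Setup n q I′) p≡n setup ,
      [ ifIdx-yes⇀ (code-pre (# 4)) (trans bound≡ (trans p≡n (sym (emb≡ zero)))) ]
      where open Setup setup
            p≡n : p ≡ n
            p≡n = trans (sym (+-identityʳ p)) p+0≡n
    loop⇛ (suc u) {n} {p} p+u+1≡n setup =
      let I″ , setup″ , f = loop⇛ u (trans (sym (+-suc p u)) p+u+1≡n) (Setup-bump setup)
      in I″ , setup″ ,
         ifIdx-no⇀ (code-pre (# 4)) (λ q → p≢n (trans (sym bound≡) (trans q (emb≡ zero)))) ∷
         (bump⇛ (code-pre (# 5)) (code-pre (# 6)) (code-pre (# 7)) (pre-↦ (# 5)) (pre-↦ (# 6)) (pre-↦ (# 7)) ++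
          goto⇀ (code-pre (# 8)) ∷ f)
      where open Setup setup
            p≢n : p ≢ n
            p≢n p≡n = m≢1+m+n p (trans p≡n (trans (sym p+u+1≡n) (+-suc p u)))

    bumps⇛ : ∀ u (t : Fin K) {n p I′ Z′} → suc (toℕ t + u) ≡ K → Setup n p I′ →
             ∃ λ I″ → Setup n (suc u + p) I″ × cfg (bumpAt t zero) Z′ I′ ⇛ enter zero Z′ I″
    bumps⇛ zero t {I′ = I′} t+1≡K setup =
      bump I′ , Setup-bump setup ,
      bump⇛ (code-bumpAt t zero) (code-bumpAt t (# 1)) (code-bumpAt t (# 2)) (bumpAt-↦ t zero) (bumpAt-↦ t (# 1))
            (bumpAt-last-↦ (trans (cong suc (sym (+-identityʳ (toℕ t)))) t+1≡K))
    bumps⇛ (suc u) t {n} {p} t+u+2≡K setup =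
      let I″ , setup″ , f = bumps⇛ u (fromℕ< t+1<K) (trans (cong (λ x → suc (x + u)) (Fin.toℕ-fromℕ< t+1<K))
                                                           (trans (cong suc (sym (+-suc (toℕ t) u))) t+u+2≡K))
                                    (Setup-bump setup)
      in I″ , subst (λ q → Setup n q I″) (+-suc (suc u) p) setup″ ,
         (bump⇛ (code-bumpAt t zero) (code-bumpAt t (# 1)) (code-bumpAt t (# 2)) (bumpAt-↦ t zero) (bumpAt-↦ t (# 1))
                (bumpAt-next-↦ (Fin.toℕ-fromℕ< t+1<K)) ++ f)
      where t+1<K : suc (toℕ t) < K
            t+1<K = subst (suc (toℕ t) <_) t+u+2≡K
                          (s≤s (subst (suc (toℕ t) ≤_) (sym (+-suc (toℕ t) u)) (s≤s (m≤m+n (toℕ t) u))))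

    initZ-beyond : ∀ n (xs : Vec (U A) (suc n)) m → suc n ≤ m → initZ (n , xs) m ≡ V.lookup xs (fromℕ n)
    initZ-beyond n xs m n<m with m <? suc n
    ... | yes m<n = contradiction (<-≤-trans m<n n<m) (<-irrefl refl)
    ... | no _    = refl

    Sim-initial : ∀ n (xs : Vec (U A) (suc n)) {I′} → Setup n (K + n) I′ →
                  Sim (initZ (n , xs)) (initI n) (initZ (n , xs)) I′
    Sim-initial n xs {I′} setup = record
      { Z≗ = λ _ → refl
      ; I≡ = emb≡
      ; invariant = record
        { layout    = layout
        ; K≤bound   = subst (K ≤_) (sym bound≡) (m≤m+n K n)
        ; emb<bound = λ j → subst₂ _<_ (sym (emb≡ j)) (sym bound≡) (≤-<-trans (initI≤n j) (m<n+m n {K} (s≤s z≤n)))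
        ; tail      = λ m bound≤m →
            trans (initZ-beyond n xs m (n<bound-≤ bound≤m)) (sym (initZ-beyond n xs _ (n<bound-≤ ≤-refl)))
        }
      }
      where
        open Setup setup
        initI≤n : ∀ j → initI n j ≤ n
        initI≤n zero    = ≤-refl
        initI≤n (suc j) = z≤n
        n<bound-≤ : ∀ {m} → I′ bound ≤ m → suc n ≤ m
        n<bound-≤ bound≤m = ≤-trans (subst (suc n ≤_) (sym bound≡) (m<n+m n {K} (s≤s z≤n))) bound≤m

    preamble : ∀ n (xs : Vec (U A) (suc n)) →
               ∃ λ I′ → init M′ (n , xs) ⇛ enter zero (initZ (n , xs)) I′ ×
                        Sim (initZ (n , xs)) (initI n) (initZ (n , xs)) I′
    preamble n xs =
      let I₁ , setup₁ , loop  = loop⇛ n refl (Setup-start n)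
          I₂ , setup₂ , bumps = bumps⇛ (K ∸ 1) zero refl setup₁
      in I₂ , start⇛ ++ (loop ++ bumps) , Sim-initial n xs setup₂

    ResNDB⇔Res : ∀ x y → ResNDB M x y ⇔ Res M′ Q′ x y
    ResNDB⇔Res (n , xs) y = mk⇔ to from
      where
        to : ResNDB M (n , xs) y → Res M′ Q′ (n , xs) y
        to (e , r , h , out) =
          let _ , prefix , sim = preamble n xs
              Z′ , I′ , r′ , sim′ = forward sim r
          in enter (label e) Z′ I′ , ⇛⇒⟶* prefix ◅◅ r′ , halted-enter h ,
             trans (sym (output-sim {l = label e} {L = entry (label e)} sim′)) out
        from : Res M′ Q′ (n , xs) y → ResNDB M (n , xs) y
        from (e′ , r , h , out) =
          let _ , prefix , sim = preamble n xs
              r′ , _ = ⇛-suffix prefix h r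
              e , r″ , h′ , out′ = backward (suc (steps r′)) sim r′ ≤-refl h
          in e , r″ , h′ , trans out′ out

theorem6p26 : (A : Structure) (i₁ i₂ : Fin (nConst A)) →
    const A i₁ ≢ const A i₂ → HasIdRelation A →
    (M : Machine A) → IsNDB M →
    Σ (Machine A) λ M′ → IsNu M′ ×
      (∀ x y → ResNDB M x y ⇔ Res M′ (PairInf (const A i₁) (const A i₂)) x y)
theorem6p26 A i₁ i₂ c₁≢c₂ (eqRel , eqRel-arity , eqRel-spec) M M-isNDB = M′ , M′-isNu , ResNDB⇔Res
  where open Simulator A i₁ eqRel eqRel-arity M
        open Correctness i₂ c₁≢c₂ eqRel-spec M-isNDB
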